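{- Let $G$ be a finite $p$-group and let $a,b\in G$ have orders $p$ and $p^i$ ($i\ge 1$) respectively. If there is a path between $a$ and $b$ in $\mathcal{G}^*_e(G)$, then $\langle a\rangle\subseteq\langle b\rangle$. In particular, if both $a$ and $b$ have order $p$ and are joined by a path in $\mathcal{G}^*_e(G)$, then $\langle a\rangle=\langle b\rangle$.
   Context: For a finite group $G$ with identity $e$, the enhanced power graph $\mathcal{G}_e(G)$ is the simple graph with vertex set $G$ in which two distinct vertices $u,v$ are adjacent iff there exists $w\in G$ such that both $u$ and $v$ are powers of $w$; $\mathcal{G}^*_e(G)$ is its induced subgraph on $G\setminus\{e\}$. A $p$-group is a group of order $p^r$, $r\in\mathbb{N}$. -}

module Defs where

open import Level using (Level; _⊔_)
open import Data.Nat using (ℕ; zero; suc; _≤_; _<_; _^_)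
open import Data.Nat.Primality using (Prime)
open import Data.Fin using (Fin)
open import Data.Product using (Σ; ∃; _×_; _,_)
open import Relation.Nullary using (¬_)
open import Relation.Binary.PropositionalEquality as ≡ using (_≡_)
open import Function.Bundles using (Bijection)
open import Algebra.Bundles using (Group)

module GroupDefs {c ℓ : Level} (G : Group c ℓ) where
  open Group G

  pow : Carrier → ℕ → Carrier
  pow x zero    = ε
  pow x (suc k) = x ∙ pow x k

  HasCard : ℕ → Set (c ⊔ ℓ)
  HasCard n = Bijection (≡.setoid (Fin n)) setoid

  IsPGroup : ℕ → Set (c ⊔ ℓ)
  IsPGroup p = Σ ℕ λ r → 1 ≤ r × HasCard (p ^ r)

  HasOrder : Carrier → ℕ → Set ℓ
  HasOrder x m = 1 ≤ m × pow x m ≈ ε × (∀ k → 1 ≤ k → k < m → ¬ (pow x k ≈ ε))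

  IsPowerOf : Carrier → Carrier → Set ℓ
  IsPowerOf u w = Σ ℕ λ k → u ≈ pow w k

  -- adjacency in the enhanced power graph G_e(G): distinct vertices that
  -- are both powers of a common element
  AdjE : Carrier → Carrier → Set (c ⊔ ℓ)
  AdjE u v = ¬ (u ≈ v) × Σ Carrier λ w → IsPowerOf u w × IsPowerOf v w

  AdjE* : Carrier → Carrier → Set (c ⊔ ℓ)
  AdjE* u v = ¬ (u ≈ ε) × ¬ (v ≈ ε) × AdjE u v

  data Path* : Carrier → Carrier → Set (c ⊔ ℓ) where
    here : ∀ {x y} → ¬ (x ≈ ε) → x ≈ y → Path* x y
    step : ∀ {x y z} → AdjE* x y → Path* y z → Path* x z

  _⊆⟨⟩_ : Carrier → Carrier → Set ℓ
  a ⊆⟨⟩ b = ∀ k → Σ ℕ λ j → pow a k ≈ pow b j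

  _≡⟨⟩_ : Carrier → Carrier → Set ℓ
  a ≡⟨⟩ b = (a ⊆⟨⟩ b) × (b ⊆⟨⟩ a)

module Submission where

-- Let a have order p and let x — y be an edge of G*ₑ(G), so x, y ∈ ⟨w⟩ for some w.
-- If a ∈ ⟨x⟩, then a ∈ ⟨w⟩.  Since G is a p-group, the order of y ≠ e is divisible by p,
-- so ⟨y⟩ contains some z ≠ e with zᵖ = e; also z ∈ ⟨w⟩.  In the cyclic group ⟨w⟩ all
-- nontrivial elements of exponent p generate the same subgroup (of order p), hence
-- a ∈ ⟨z⟩ ⊆ ⟨y⟩.  Walking along a path from a to b shows a ∈ ⟨b⟩, i.e. ⟨a⟩ ⊆ ⟨b⟩; if b also
-- has order p, the same cyclic-group fact applied inside ⟨b⟩ gives b ∈ ⟨a⟩.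

open import Level using (Level)
open import Function.Base using (_∘_; case_of_)
open import Function.Bundles using (Inverse)
open import Function.Definitions using (Injective)
open import Function.Properties.Bijection using (Bijection⇒Inverse)
open import Data.Bool.Base using (Bool; true; false; _∧_; _∨_; not)
open import Data.Bool.Properties using (∧-zeroʳ; ∨-zeroʳ; ∧-conicalˡ; ∧-conicalʳ; not-injective; ¬-not)
open import Data.Empty using (⊥-elim)
open import Data.Fin.Base as Fin using (Fin; toℕ; fromℕ<)
open import Data.Fin.Properties using (_≟_; 0≢1+n; suc-injective; toℕ-injective; toℕ<n; toℕ-fromℕ<; pigeonhole)
open import Data.Nat.Base using (ℕ; zero; suc; pred; _+_; _*_; _∸_; _≤_; _<_; _^_; z≤n; s≤s; z<s; NonZero; >-nonZero; nonTrivial⇒n>1)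
open import Data.Nat.Properties as ℕ using (+-suc; +-comm; *-comm; *-assoc; *-zeroʳ; <-cmp; <-trans; ≤-<-trans; <⇒≤; m∸n≤m; m<n⇒0<n∸m; m+[n∸m]≡n; m∸n+n≡m; m<m+n; m<m*n; n<1+n; n≢0⇒n>0; suc-pred; _≤?_; anyUpTo?; +-commutativeSemigroup)
open import Data.Nat.Divisibility using (_∣_; divides; _∣?_; _∣0; ∣-refl; ∣1⇒≡1; ∣m∣n⇒∣m+n; *-cancelʳ-∣; m%n≡0⇒n∣m)
open import Data.Nat.DivMod using (_%_; _/_; m≡m%n+[m/n]*n; m%n<n)
open import Data.Nat.Primality using (Prime; prime⇒irreducible; prime⇒nonZero; prime⇒nonTrivial)
open import Data.Nat.Coprimality using (Coprime; coprime-divisor; coprime-Bézout)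
open import Data.Nat.GCD using (module Bézout)
open import Data.Nat.GeneralisedArithmetic using (fold; fold-+)
open import Data.Nat.Induction using (<-rec)
open import Data.Product using (_×_; _,_; ∃; proj₁; proj₂)
open import Data.Sum using (inj₁; inj₂)
open import Relation.Nullary using (¬_; yes; no)
open import Relation.Nullary.Decidable using (Dec; does; map′; dec-true; _×-dec_)
open import Relation.Unary using (Decidable)
open import Relation.Binary.PropositionalEquality as ≡ using (_≡_; _≢_; refl; sym; trans; cong; cong₂; subst)
open import Relation.Binary.Definitions using (tri<; tri≈; tri>)
open import Algebra.Bundles using (Group)
open import Algebra.Properties.CommutativeSemigroup +-commutativeSemigroup using (interchange)
open import Defs

-- (1) Decidable subsets of Fin n, given by their characteristic functions.

Subset : ℕ → Set
Subset n = Fin n → Bool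

_∖_ : ∀ {n} → Subset n → Subset n → Subset n
(S ∖ T) i = S i ∧ not (T i)

_∩_ : ∀ {n} → Subset n → Subset n → Subset n
(S ∩ T) i = S i ∧ T i

_⊆_ : ∀ {n} → Subset n → Subset n → Set
S ⊆ T = ∀ i → S i ≡ true → T i ≡ true

χ : Bool → ℕ
χ true  = 1
χ false = 0

size : ∀ {n} → Subset n → ℕ
size {zero}  S = 0
size {suc n} S = χ (S Fin.zero) + size (S ∘ Fin.suc)

size-cong : ∀ {n} {S T : Subset n} → (∀ i → S i ≡ T i) → size S ≡ size T
size-cong {zero}  S≗T = refl
size-cong {suc n} S≗T = cong₂ _+_ (cong χ (S≗T Fin.zero)) (size-cong (S≗T ∘ Fin.suc))

size-empty : ∀ n → size {n} (λ _ → false) ≡ 0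
size-empty zero    = refl
size-empty (suc n) = size-empty n

size-full : ∀ n → size {n} (λ _ → true) ≡ n
size-full zero    = refl
size-full (suc n) = cong suc (size-full n)

size-split : ∀ {n} (S T : Subset n) → size S ≡ size (S ∖ T) + size (S ∩ T)
size-split {zero}  S T = refl
size-split {suc n} S T =
  trans (cong₂ _+_ (χ-split (S Fin.zero) (T Fin.zero)) (size-split (S ∘ Fin.suc) (T ∘ Fin.suc)))
        (interchange (χ (S Fin.zero ∧ not (T Fin.zero))) (χ (S Fin.zero ∧ T Fin.zero))
                     (size ((S ∖ T) ∘ Fin.suc)) (size ((S ∩ T) ∘ Fin.suc)))
  where
  χ-split : ∀ s t → χ s ≡ χ (s ∧ not t) + χ (s ∧ t)
  χ-split true  true  = refl
  χ-split true  false = refl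
  χ-split false t     = refl

size-remove : ∀ {n} (S O : Subset n) → O ⊆ S → size S ≡ size (S ∖ O) + size O
size-remove S O O⊆S = trans (size-split S O) (cong (size (S ∖ O) +_) (size-cong S∩O≗O))
  where
  S∩O≗O : ∀ i → S i ∧ O i ≡ O i
  S∩O≗O i with O i in i∈O
  ... | false = ∧-zeroʳ (S i)
  ... | true  rewrite O⊆S i i∈O = refl

element : ∀ {n} (S : Subset n) → 0 < size S → ∃ λ i → S i ≡ true
element {suc n} S 0<|S| with S Fin.zero in 0∈S
... | true  = Fin.zero , 0∈S
... | false with element (S ∘ Fin.suc) 0<|S|
...   | i , i+1∈S = Fin.suc i , i+1∈S

image : ∀ {m n} → (Fin m → Fin n) → Subset n
image {zero}  f j = false
image {suc m} f j = does (f Fin.zero ≟ j) ∨ image (f ∘ Fin.suc) j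

image-sound : ∀ {m n} (f : Fin m → Fin n) j → image f j ≡ true → ∃ λ k → f k ≡ j
image-sound {suc m} f j j∈image with f Fin.zero ≟ j
... | yes f0≡j = Fin.zero , f0≡j
... | no _ with image-sound (f ∘ Fin.suc) j j∈image
...   | k , fk+1≡j = Fin.suc k , fk+1≡j

image-complete : ∀ {m n} (f : Fin m → Fin n) k → image f (f k) ≡ true
image-complete {suc m} f Fin.zero =
  cong (_∨ image (f ∘ Fin.suc) (f Fin.zero)) (dec-true (f Fin.zero ≟ f Fin.zero) refl)
image-complete {suc m} f (Fin.suc k) =
  trans (cong (does (f Fin.zero ≟ f (Fin.suc k)) ∨_) (image-complete (f ∘ Fin.suc) k)) (∨-zeroʳ _)

size-insert : ∀ {n} (x : Fin n) (T : Subset n) → T x ≡ false →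
  size (λ i → does (x ≟ i) ∨ T i) ≡ suc (size T)
size-insert {suc n} Fin.zero    T x∉T rewrite x∉T = refl
size-insert {suc n} (Fin.suc x) T x∉T =
  trans (cong (χ (T Fin.zero) +_) (size-insert x (T ∘ Fin.suc) x∉T)) (+-suc _ _)

size-image : ∀ {m n} (f : Fin m → Fin n) → Injective _≡_ _≡_ f → size (image f) ≡ m
size-image {zero}  {n} f _     = size-empty n
size-image {suc m}     f f-inj =
  trans (size-insert (f Fin.zero) (image (f ∘ Fin.suc)) f0-new)
        (cong suc (size-image (f ∘ Fin.suc) (λ eq → suc-injective (f-inj eq))))
  where
  f0-new : image (f ∘ Fin.suc) (f Fin.zero) ≡ false
  f0-new = ¬-not λ f0∈image →
    0≢1+n (sym (f-inj (proj₂ (image-sound (f ∘ Fin.suc) (f Fin.zero) f0∈image))))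

-- (2) Let σ be a permutation of Fin n all of whose orbits have exactly m points: σᵐ = id
-- and σᵏ has no fixed point for 0 < k < m (σᵏ(i) is written fold i σ k).  Every σ-closed
-- set is a disjoint union of orbits, so m divides its size; in particular m ∣ n.

module FreeCyclicAction {n : ℕ} (σ : Fin n → Fin n) (σ-injective : Injective _≡_ _≡_ σ)
  (m : ℕ) (1≤m : 1 ≤ m) (σᵐ≗id : ∀ i → fold i σ m ≡ i)
  (σᵏ-fixed-point-free : ∀ i k → 1 ≤ k → k < m → fold i σ k ≢ i) where

  σᵏ-injective : ∀ k {i j} → fold i σ k ≡ fold j σ k → i ≡ j
  σᵏ-injective zero    eq = eq
  σᵏ-injective (suc k) eq = σᵏ-injective k (σ-injective eq)

  distinct-below-period : ∀ i {a b} → a < b → b < m → fold i σ a ≢ fold i σ b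
  distinct-below-period i {a} {b} a<b b<m σᵃi≡σᵇi =
    σᵏ-fixed-point-free i (b ∸ a) (m<n⇒0<n∸m a<b) (≤-<-trans (m∸n≤m b a) b<m)
      (sym (σᵏ-injective a (begin
        fold i σ a                  ≡⟨ σᵃi≡σᵇi ⟩
        fold i σ b                  ≡⟨ cong (fold i σ) (m+[n∸m]≡n (<⇒≤ a<b)) ⟨
        fold i σ (a + (b ∸ a))      ≡⟨ fold-+ i σ a ⟩
        fold (fold i σ (b ∸ a)) σ a ∎)))
    where open ≡.≡-Reasoning

  orbitMap : Fin n → Fin m → Fin n
  orbitMap i k = fold i σ (toℕ k)

  orbitMap-injective : ∀ i → Injective _≡_ _≡_ (orbitMap i)
  orbitMap-injective i {k} {l} eq with <-cmp (toℕ k) (toℕ l)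
  ... | tri< k<l _ _ = ⊥-elim (distinct-below-period i k<l (toℕ<n l) eq)
  ... | tri≈ _ k≡l _ = toℕ-injective k≡l
  ... | tri> _ _ l<k = ⊥-elim (distinct-below-period i l<k (toℕ<n k) (sym eq))

  Orbit : Fin n → Subset n
  Orbit i = image (orbitMap i)

  size-Orbit : ∀ i → size (Orbit i) ≡ m
  size-Orbit i = size-image (orbitMap i) (orbitMap-injective i)

  σᵏ∈Orbit : ∀ i {k} → k < m → Orbit i (fold i σ k) ≡ true
  σᵏ∈Orbit i {k} k<m = subst (λ l → Orbit i (fold i σ l) ≡ true) (toℕ-fromℕ< k<m)
    (image-complete (orbitMap i) (fromℕ< k<m))

  Orbit-σ⁻¹-closed : ∀ i j → Orbit i (σ j) ≡ true → Orbit i j ≡ true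
  Orbit-σ⁻¹-closed i j σj∈Orbit with image-sound (orbitMap i) (σ j) σj∈Orbit
  ... | k , σᵏi≡σj = preimage (toℕ k) (toℕ<n k) σᵏi≡σj
    where
    preimage : ∀ k → k < m → fold i σ k ≡ σ j → Orbit i j ≡ true
    preimage (suc k) k+1<m σᵏ⁺¹i≡σj =
      subst (λ x → Orbit i x ≡ true) (σ-injective σᵏ⁺¹i≡σj) (σᵏ∈Orbit i (<-trans (n<1+n k) k+1<m))
    preimage zero _ i≡σj =
      subst (λ x → Orbit i x ≡ true) (σ-injective σᵐi≡σj) (σᵏ∈Orbit i (ℕ.≤-reflexive (suc-pred m)))
      where
      instance
        m-nonZero : NonZero m
        m-nonZero = >-nonZero 1≤m
      σᵐi≡σj : fold i σ (suc (pred m)) ≡ σ j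
      σᵐi≡σj = trans (cong (fold i σ) (suc-pred m)) (trans (σᵐ≗id i) i≡σj)

  Closed : Subset n → Set
  Closed S = ∀ j → S j ≡ true → S (σ j) ≡ true

  Orbit⊆closed : ∀ {S} i → Closed S → S i ≡ true → Orbit i ⊆ S
  Orbit⊆closed {S} i S-closed i∈S j j∈Orbit with image-sound (orbitMap i) j j∈Orbit
  ... | k , refl = σᵏi∈S (toℕ k)
    where
    σᵏi∈S : ∀ k → S (fold i σ k) ≡ true
    σᵏi∈S zero    = i∈S
    σᵏi∈S (suc k) = S-closed _ (σᵏi∈S k)

  -- Removing an orbit from a closed set leaves a closed set (by backward closure of orbits).
  ∖Orbit-closed : ∀ {S} i → Closed S → Closed (S ∖ Orbit i)
  ∖Orbit-closed {S} i S-closed j j∈S∖Orbit = cong₂ _∧_ (S-closed j j∈S) (cong not σj∉Orbit)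
    where
    j∈S : S j ≡ true
    j∈S = ∧-conicalˡ (S j) _ j∈S∖Orbit
    j∉Orbit : Orbit i j ≡ false
    j∉Orbit = not-injective (∧-conicalʳ (S j) _ j∈S∖Orbit)
    σj∉Orbit : Orbit i (σ j) ≡ false
    σj∉Orbit = ¬-not λ σj∈Orbit →
      case trans (sym j∉Orbit) (Orbit-σ⁻¹-closed i j σj∈Orbit) of λ ()

  remove-orbit : ∀ S → Closed S → 0 < size S → ∃ λ S′ → Closed S′ × size S ≡ size S′ + m
  remove-orbit S S-closed 0<|S| with element S 0<|S|
  ... | i , i∈S = S ∖ Orbit i , ∖Orbit-closed i S-closed ,
    trans (size-remove S (Orbit i) (Orbit⊆closed i S-closed i∈S)) (cong (size (S ∖ Orbit i) +_) (size-Orbit i))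

  m∣size-closed : ∀ S → Closed S → m ∣ size S
  m∣size-closed S = <-rec P induction (size S) S refl
    where
    P : ℕ → Set
    P c = ∀ S → size S ≡ c → Closed S → m ∣ c
    induction : ∀ c → (∀ {c′} → c′ < c → P c′) → P c
    induction zero    _       _ _ _ = m ∣0
    induction (suc c) smaller S |S|≡1+c S-closed
      with remove-orbit S S-closed (subst (0 <_) (sym |S|≡1+c) z<s)
    ... | S′ , S′-closed , |S|≡|S′|+m =
      subst (m ∣_) (trans (sym |S|≡|S′|+m) |S|≡1+c)
        (∣m∣n⇒∣m+n (smaller |S′|<1+c S′ refl S′-closed) ∣-refl)
      where
      |S′|<1+c : size S′ < suc c
      |S′|<1+c = subst (size S′ <_) (trans (sym |S|≡|S′|+m) |S|≡1+c) (m<m+n (size S′) 1≤m)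

  m∣n : m ∣ n
  m∣n = subst (m ∣_) (size-full n) (m∣size-closed (λ _ → true) (λ _ _ → refl))

LeastPositive : ∀ {a} → (ℕ → Set a) → ℕ → Set a
LeastPositive P m = 1 ≤ m × P m × (∀ k → 1 ≤ k → k < m → ¬ P k)

least-positive : ∀ {a} {P : ℕ → Set a} → Decidable P → ∀ d → 1 ≤ d → P d → ∃ (LeastPositive P)
least-positive {P = P} P? = <-rec _ search
  where
  search : ∀ d → (∀ {k} → k < d → 1 ≤ k → P k → ∃ (LeastPositive P)) →
    1 ≤ d → P d → ∃ (LeastPositive P)
  search d below 1≤d Pd with anyUpTo? (λ k → (1 ≤? k) ×-dec P? k) d
  ... | yes (k , k<d , 1≤k , Pk) = below k<d 1≤k Pk
  ... | no  none                 = d , 1≤d , Pd , λ k 1≤k k<d Pk → none (k , k<d , 1≤k , Pk)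

prime≥2 : ∀ {p} → Prime p → 2 ≤ p
prime≥2 {p} p-prime = nonTrivial⇒n>1 p {{prime⇒nonTrivial p-prime}}

coprime-to-prime : ∀ {p d} → Prime p → ¬ p ∣ d → Coprime d p
coprime-to-prime p-prime p∤d (c∣d , c∣p) with prime⇒irreducible p-prime c∣p
... | inj₁ c≡1  = c≡1
... | inj₂ refl = ⊥-elim (p∤d c∣d)

prime-power-divisor : ∀ {p d} r → Prime p → d ∣ p ^ r → ¬ p ∣ d → d ≡ 1
prime-power-divisor zero    p-prime d∣1    p∤d = ∣1⇒≡1 d∣1
prime-power-divisor (suc r) p-prime d∣ppʳ p∤d =
  prime-power-divisor r p-prime (coprime-divisor (coprime-to-prime p-prime p∤d) d∣ppʳ) p∤d

prime-divides-modulus : ∀ {p M α} → Prime p → M ∣ α * p → ¬ M ∣ α → p ∣ M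
prime-divides-modulus {p} {M} {α} p-prime M∣αp M∤α with p ∣? M
... | yes p∣M = p∣M
... | no  p∤M = ⊥-elim (M∤α (coprime-divisor (coprime-to-prime p-prime p∤M) (subst (M ∣_) (*-comm α p) M∣αp)))

cofactor : ∀ {p K α} → Prime p → K * p ∣ α * p → ¬ K * p ∣ α → ∃ λ α′ → α ≡ α′ * K × ¬ p ∣ α′
cofactor {p} {K} {α} p-prime Kp∣αp Kp∤α with *-cancelʳ-∣ p {{prime⇒nonZero p-prime}} Kp∣αp
... | divides α′ α≡α′K = α′ , α≡α′K , p∤α′
  where
  open ≡.≡-Reasoning
  p∤α′ : ¬ p ∣ α′
  p∤α′ (divides c α′≡cp) = Kp∤α (divides c (begin
    α           ≡⟨ α≡α′K ⟩
    α′ * K      ≡⟨ cong (_* K) α′≡cp ⟩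
    c * p * K   ≡⟨ *-assoc c p K ⟩
    c * (p * K) ≡⟨ cong (c *_) (*-comm p K) ⟩
    c * (K * p) ∎))

-- (4) Powers and orders in an arbitrary group.

module PowerLaws {c ℓ : Level} (G : Group c ℓ) where
  open Group G renaming (refl to ≈-refl; sym to ≈-sym; trans to ≈-trans)
  open GroupDefs G
  open import Algebra.Properties.Monoid.Mult monoid using (×-congʳ; ×-congˡ; ×-homo-+; ×-assocˡ)
    renaming (_×_ to _×ᵐ_)
  open import Algebra.Properties.Group G using (∙-cancelʳ)
  open import Relation.Binary.Reasoning.Setoid setoid

  -- pow agrees with the library's repeated multiplication, whose laws we reuse.
  pow≡× : ∀ x k → pow x k ≡ k ×ᵐ x
  pow≡× x zero    = refl
  pow≡× x (suc k) = cong (x ∙_) (pow≡× x k)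

  pow-cong : ∀ {x y} k → x ≈ y → pow x k ≈ pow y k
  pow-cong {x} {y} k x≈y rewrite pow≡× x k | pow≡× y k = ×-congʳ k x≈y

  pow-+ : ∀ x a b → pow x (a + b) ≈ pow x a ∙ pow x b
  pow-+ x a b rewrite pow≡× x (a + b) | pow≡× x a | pow≡× x b = ×-homo-+ x a b

  pow-* : ∀ x a b → pow (pow x a) b ≈ pow x (a * b)
  pow-* x a b rewrite pow≡× x a | pow≡× (a ×ᵐ x) b | pow≡× x (a * b) =
    ≈-trans (×-assocˡ x b a) (×-congˡ (*-comm b a))

  pow-ε : ∀ k → pow ε k ≈ ε
  pow-ε zero    = ≈-refl
  pow-ε (suc k) = ≈-trans (identityˡ _) (pow-ε k)

  pow-multiple : ∀ {x M} q → pow x M ≈ ε → pow x (q * M) ≈ ε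
  pow-multiple {x} {M} q xᴹ≈ε = begin
    pow x (q * M)   ≡⟨ cong (pow x) (*-comm q M) ⟩
    pow x (M * q)   ≈⟨ pow-* x M q ⟨
    pow (pow x M) q ≈⟨ pow-cong q xᴹ≈ε ⟩
    pow ε q         ≈⟨ pow-ε q ⟩
    ε               ∎

  power-period : ∀ {g N} k → pow g N ≈ ε → pow (pow g k) N ≈ ε
  power-period {g} {N} k gᴺ≈ε = ≈-trans (pow-* g k N) (pow-multiple k gᴺ≈ε)

  pow-mod : ∀ {x M} .{{_ : NonZero M}} k → pow x M ≈ ε → pow x k ≈ pow x (k % M)
  pow-mod {x} {M} k xᴹ≈ε = begin
    pow x k                             ≡⟨ cong (pow x) (m≡m%n+[m/n]*n k M) ⟩
    pow x (k % M + (k / M) * M)         ≈⟨ pow-+ x (k % M) _ ⟩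
    pow x (k % M) ∙ pow x ((k / M) * M) ≈⟨ ∙-congˡ (pow-multiple (k / M) xᴹ≈ε) ⟩
    pow x (k % M) ∙ ε                   ≈⟨ identityʳ _ ⟩
    pow x (k % M)                       ∎

  order-divides : ∀ {x m} k → HasOrder x m → pow x k ≈ ε → m ∣ k
  order-divides {x} {m} k (1≤m , xᵐ≈ε , minimal) xᵏ≈ε = m%n≡0⇒n∣m k m k%m≡0
    where
    instance
      m-nonZero : NonZero m
      m-nonZero = >-nonZero 1≤m
    k%m≡0 : k % m ≡ 0
    k%m≡0 with k % m ℕ.≟ 0
    ... | yes k%m≡0 = k%m≡0
    ... | no  k%m≢0 = ⊥-elim (minimal (k % m) (n≢0⇒n>0 k%m≢0) (m%n<n k m)
                                (≈-trans (≈-sym (pow-mod k xᵐ≈ε)) xᵏ≈ε))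

  divides-order : ∀ {x m k} → HasOrder x m → m ∣ k → pow x k ≈ ε
  divides-order (_ , xᵐ≈ε , _) (divides q refl) = pow-multiple q xᵐ≈ε

  order≥2⇒nontrivial : ∀ {x m} → HasOrder x m → 2 ≤ m → ¬ x ≈ ε
  order≥2⇒nontrivial {x} (_ , _ , minimal) 2≤m x≈ε = minimal 1 (s≤s z≤n) 2≤m (≈-trans (identityʳ x) x≈ε)

  cofactor-power : ∀ {x K q} → 2 ≤ q → HasOrder x (K * q) → ¬ pow x K ≈ ε × pow (pow x K) q ≈ ε
  cofactor-power {x} {zero}      2≤q (() , _)
  cofactor-power {x} {K@(suc _)} {q} 2≤q (_ , xᴷᵠ≈ε , minimal) =
    minimal K (s≤s z≤n) (m<m*n K q 2≤q) , ≈-trans (pow-* x K q) xᴷᵠ≈ε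

  power-refl : ∀ x → IsPowerOf x x
  power-refl x = 1 , ≈-sym (identityʳ x)

  power-trans : ∀ {x y z} → IsPowerOf x y → IsPowerOf y z → IsPowerOf x z
  power-trans {z = z} (j , x≈yʲ) (k , y≈zᵏ) = k * j , ≈-trans x≈yʲ (≈-trans (pow-cong j y≈zᵏ) (pow-* z k j))

  power⇒⊆⟨⟩ : ∀ {a b} → IsPowerOf a b → a ⊆⟨⟩ b
  power⇒⊆⟨⟩ {b = b} (j , a≈bʲ) k = j * k , ≈-trans (pow-cong k a≈bʲ) (pow-* b j k)

  inverse-is-power : ∀ {h u} N → pow h (suc N) ≈ ε → u ∙ h ≈ ε → u ≈ pow h N
  inverse-is-power {h} {u} N hᴺ⁺¹≈ε uh≈ε = ∙-cancelʳ h u (pow h N) (begin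
    u ∙ h             ≈⟨ uh≈ε ⟩
    ε                 ≈⟨ hᴺ⁺¹≈ε ⟨
    pow h (suc N)     ≡⟨ cong (pow h) (+-comm 1 N) ⟩
    pow h (N + 1)     ≈⟨ pow-+ h N 1 ⟩
    pow h N ∙ pow h 1 ≈⟨ ∙-congˡ (identityʳ h) ⟩
    pow h N ∙ h       ∎)

  -- If gᴺ = e and b is prime to N, then g is a power of gᵇ (b is invertible modulo N).
  generator-of-coprime-power : ∀ {g b} N → pow g N ≈ ε → Coprime b N → IsPowerOf g (pow g b)
  generator-of-coprime-power {g} {b} N gᴺ≈ε b⊥N with coprime-Bézout b⊥N
  ... | Bézout.+- x y 1+yN≡xb = x , (begin
    g                 ≈⟨ identityʳ g ⟨
    g ∙ ε             ≈⟨ ∙-congˡ (pow-multiple y gᴺ≈ε) ⟨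
    pow g (1 + y * N) ≡⟨ cong (pow g) (trans 1+yN≡xb (*-comm x b)) ⟩
    pow g (b * x)     ≈⟨ pow-* g b x ⟨
    pow (pow g b) x   ∎)
  generator-of-coprime-power zero    gᴺ≈ε b⊥N | Bézout.-+ x y 1+xb≡y*0 =
    case trans 1+xb≡y*0 (*-zeroʳ y) of λ ()
  generator-of-coprime-power {g} {b} (suc N) gᴺ≈ε b⊥N | Bézout.-+ x y 1+xb≡yN =
    power-trans (N , inverse-is-power N gᵇˣ-period g∙gᵇˣ≈ε) (x , ≈-refl)
    where
    gᵇˣ-period : pow (pow (pow g b) x) (suc N) ≈ ε
    gᵇˣ-period = power-period {N = suc N} x (power-period {N = suc N} b gᴺ≈ε)
    g∙gᵇˣ≈ε : g ∙ pow (pow g b) x ≈ ε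
    g∙gᵇˣ≈ε = begin
      g ∙ pow (pow g b) x ≈⟨ ∙-congˡ (pow-* g b x) ⟩
      pow g (1 + b * x)   ≡⟨ cong (pow g) (trans (cong suc (*-comm b x)) 1+xb≡yN) ⟩
      pow g (y * suc N)   ≈⟨ pow-multiple y gᴺ≈ε ⟩
      ε                   ∎

  -- Exponent form of "a ∈ ⟨w⟩ is nontrivial with aᵖ = e", where M is the order of w.
  torsion-exponent : ∀ {w M a α p} → HasOrder w M → a ≈ pow w α → ¬ a ≈ ε → pow a p ≈ ε →
    M ∣ α * p × ¬ M ∣ α
  torsion-exponent {w} {M} {a} {α} {p} ord-w a≈wᵅ a≢ε aᵖ≈ε =
    order-divides (α * p) ord-w (begin
      pow w (α * p)   ≈⟨ pow-* w α p ⟨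
      pow (pow w α) p ≈⟨ pow-cong p a≈wᵅ ⟨
      pow a p         ≈⟨ aᵖ≈ε ⟩
      ε               ∎) ,
    λ M∣α → a≢ε (≈-trans a≈wᵅ (divides-order ord-w M∣α))

  -- In a cyclic group ⟨w⟩, the nontrivial elements of exponent p (p prime) all generate the
  -- same subgroup: writing |⟨w⟩| = Kp and g = wᴷ, both a and z are powers of g, and g is a
  -- power of z because z = g^β′ with p ∤ β′.
  cyclic-p-torsion : ∀ {w M a z p} → Prime p → HasOrder w M → IsPowerOf a w → IsPowerOf z w →
    ¬ a ≈ ε → ¬ z ≈ ε → pow a p ≈ ε → pow z p ≈ ε → IsPowerOf a z
  cyclic-p-torsion {w} {M} {a} {z} {p} p-prime ord-w (α , a≈wᵅ) (β , z≈wᵝ) a≢ε z≢ε aᵖ≈ε zᵖ≈ε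
    with torsion-exponent {α = α} {p = p} ord-w a≈wᵅ a≢ε aᵖ≈ε
       | torsion-exponent {α = β} {p = p} ord-w z≈wᵝ z≢ε zᵖ≈ε
  ... | M∣αp , M∤α | M∣βp , M∤β with prime-divides-modulus p-prime M∣αp M∤α
  ... | divides K refl with cofactor {K = K} p-prime M∣αp M∤α | cofactor {K = K} p-prime M∣βp M∤β
  ... | α′ , α≡α′K , _ | β′ , β≡β′K , p∤β′ =
    power-trans (α′ , in-⟨g⟩ α′ a≈wᵅ α≡α′K)
      (power-trans (generator-of-coprime-power p gᵖ≈ε (coprime-to-prime p-prime p∤β′))
                   (1 , ≈-trans (≈-sym (in-⟨g⟩ β′ z≈wᵝ β≡β′K)) (≈-sym (identityʳ z))))
    where
    g : Carrier
    g = pow w K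
    gᵖ≈ε : pow g p ≈ ε
    gᵖ≈ε = ≈-trans (pow-* w K p) (proj₁ (proj₂ ord-w))
    in-⟨g⟩ : ∀ {x γ} γ′ → x ≈ pow w γ → γ ≡ γ′ * K → x ≈ pow g γ′
    in-⟨g⟩ {x} {γ} γ′ x≈wᵞ γ≡γ′K = begin
      x             ≈⟨ x≈wᵞ ⟩
      pow w γ       ≡⟨ cong (pow w) (trans γ≡γ′K (*-comm γ′ K)) ⟩
      pow w (K * γ′) ≈⟨ pow-* w K γ′ ⟨
      pow g γ′      ∎

  order-p-power-symmetric : ∀ {a b p} → Prime p → HasOrder a p → HasOrder b p →
    IsPowerOf a b → IsPowerOf b a
  order-p-power-symmetric {a} {b} p-prime ord-a ord-b a∈⟨b⟩ =
    cyclic-p-torsion p-prime ord-b (power-refl b) a∈⟨b⟩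
      (order≥2⇒nontrivial ord-b (prime≥2 p-prime)) (order≥2⇒nontrivial ord-a (prime≥2 p-prime))
      (proj₁ (proj₂ ord-b)) (proj₁ (proj₂ ord-a))

-- (5) Finite groups: every element has an order, and it divides |G|.

module FiniteGroup {c ℓ : Level} (G : Group c ℓ) {n : ℕ} (card : GroupDefs.HasCard G n) where
  open Group G renaming (refl to ≈-refl; sym to ≈-sym; trans to ≈-trans)
  open GroupDefs G
  open PowerLaws G
  open Inverse (Bijection⇒Inverse card) using (to; from; from-cong; strictlyInverseˡ; strictlyInverseʳ)
  open import Algebra.Properties.Group G using (∙-cancelˡ; ∙-cancelʳ)
  open import Relation.Binary.Reasoning.Setoid setoid

  from-injective : ∀ {u v} → from u ≡ from v → u ≈ v
  from-injective {u} {v} eq = begin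
    u           ≈⟨ strictlyInverseˡ u ⟨
    to (from u) ≡⟨ cong to eq ⟩
    to (from v) ≈⟨ strictlyInverseˡ v ⟩
    v           ∎

  to-injective : ∀ {i j} → to i ≈ to j → i ≡ j
  to-injective {i} {j} eq = trans (sym (strictlyInverseʳ i)) (trans (from-cong eq) (strictlyInverseʳ j))

  _≈?_ : ∀ u v → Dec (u ≈ v)
  u ≈? v = map′ from-injective from-cong (from u ≟ from v)

  -- By pigeonhole two of x⁰, …, xⁿ coincide, so some positive power of x is e.
  period-exists : ∀ x → ∃ λ d → 1 ≤ d × pow x d ≈ ε
  period-exists x with pigeonhole (n<1+n n) (λ (k : Fin (suc n)) → from (pow x (toℕ k)))
  ... | i , j , i<j , xⁱ≡xʲ = d , m<n⇒0<n∸m i<j , ∙-cancelʳ (pow x (toℕ i)) _ _ (begin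
    pow x d ∙ pow x (toℕ i) ≈⟨ pow-+ x d (toℕ i) ⟨
    pow x (d + toℕ i)       ≡⟨ cong (pow x) (m∸n+n≡m (<⇒≤ i<j)) ⟩
    pow x (toℕ j)           ≈⟨ from-injective xⁱ≡xʲ ⟨
    pow x (toℕ i)           ≈⟨ identityˡ _ ⟨
    ε ∙ pow x (toℕ i)       ∎)
    where
    d : ℕ
    d = toℕ j ∸ toℕ i

  order-exists : ∀ x → ∃ λ m → HasOrder x m
  order-exists x with period-exists x
  ... | d , 1≤d , xᵈ≈ε = least-positive (λ k → pow x k ≈? ε) d 1≤d xᵈ≈ε

  -- Lagrange for cyclic subgroups: left multiplication by x permutes the indices Fin n, and
  -- its orbits (the cosets of ⟨x⟩) all have size the order of x.
  order-divides-card : ∀ {x m} → HasOrder x m → m ∣ n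
  order-divides-card {x} {m} (1≤m , xᵐ≈ε , minimal) =
    FreeCyclicAction.m∣n σ σ-injective m 1≤m σᵐ≗id σᵏ-fixed-point-free
    where
    σ : Fin n → Fin n
    σ i = from (x ∙ to i)
    σ-injective : Injective _≡_ _≡_ σ
    σ-injective eq = to-injective (∙-cancelˡ x _ _ (from-injective eq))
    to-σᵏ : ∀ k i → to (fold i σ k) ≈ pow x k ∙ to i
    to-σᵏ zero    i = ≈-sym (identityˡ _)
    to-σᵏ (suc k) i = begin
      to (σ (fold i σ k))  ≈⟨ strictlyInverseˡ _ ⟩
      x ∙ to (fold i σ k)  ≈⟨ ∙-congˡ (to-σᵏ k i) ⟩
      x ∙ (pow x k ∙ to i) ≈⟨ assoc _ _ _ ⟨
      pow x (suc k) ∙ to i ∎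
    σᵐ≗id : ∀ i → fold i σ m ≡ i
    σᵐ≗id i = to-injective (≈-trans (to-σᵏ m i) (≈-trans (∙-congʳ xᵐ≈ε) (identityˡ _)))
    σᵏ-fixed-point-free : ∀ i k → 1 ≤ k → k < m → fold i σ k ≢ i
    σᵏ-fixed-point-free i k 1≤k k<m σᵏi≡i = minimal k 1≤k k<m (∙-cancelʳ (to i) _ _ (begin
      pow x k ∙ to i  ≈⟨ to-σᵏ k i ⟨
      to (fold i σ k) ≡⟨ cong to σᵏi≡i ⟩
      to i            ≈⟨ identityˡ _ ⟨
      ε ∙ to i        ∎))

-- (6) Finite p-groups and paths in G*ₑ(G).

module PGroup {c ℓ : Level} (G : Group c ℓ) {p : ℕ} (p-prime : Prime p)
  (p-group : GroupDefs.IsPGroup G p) where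
  open Group G renaming (refl to ≈-refl; sym to ≈-sym; trans to ≈-trans)
  open GroupDefs G
  open PowerLaws G
  open FiniteGroup G (proj₂ (proj₂ p-group)) using (order-exists; order-divides-card)

  p∣order : ∀ {y d} → HasOrder y d → ¬ y ≈ ε → p ∣ d
  p∣order {y} {d} ord-y y≢ε with p ∣? d
  ... | yes p∣d = p∣d
  ... | no  p∤d = ⊥-elim (y≢ε (≈-trans (≈-sym (identityʳ y))
    (subst (λ k → pow y k ≈ ε) (prime-power-divisor (proj₁ p-group) p-prime (order-divides-card ord-y) p∤d)
           (proj₁ (proj₂ ord-y)))))

  p-torsion-power : ∀ {y} → ¬ y ≈ ε → ∃ λ K → ¬ pow y K ≈ ε × pow (pow y K) p ≈ ε
  p-torsion-power {y} y≢ε with order-exists y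
  ... | d , ord-y with p∣order ord-y y≢ε
  ... | divides K refl = K , cofactor-power {K = K} (prime≥2 p-prime) ord-y

  edge-preserves-power : ∀ {a x y} → HasOrder a p → AdjE* x y → IsPowerOf a x → IsPowerOf a y
  edge-preserves-power {a} ord-a (_ , y≢ε , _ , w , x∈⟨w⟩ , y∈⟨w⟩) a∈⟨x⟩
    with p-torsion-power y≢ε | order-exists w
  ... | K , yᴷ≢ε , yᴷᵖ≈ε | M , ord-w =
    power-trans
      (cyclic-p-torsion p-prime ord-w (power-trans a∈⟨x⟩ x∈⟨w⟩) (power-trans (K , ≈-refl) y∈⟨w⟩)
        (order≥2⇒nontrivial ord-a (prime≥2 p-prime)) yᴷ≢ε (proj₁ (proj₂ ord-a)) yᴷᵖ≈ε)
      (K , ≈-refl)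

  path-preserves-power : ∀ {a x y} → HasOrder a p → Path* x y → IsPowerOf a x → IsPowerOf a y
  path-preserves-power ord-a (here _ x≈y)   (k , a≈xᵏ) = k , ≈-trans a≈xᵏ (pow-cong k x≈y)
  path-preserves-power ord-a (step x—y path) a∈⟨x⟩ =
    path-preserves-power ord-a path (edge-preserves-power ord-a x—y a∈⟨x⟩)

  reachable⇒power : ∀ {a b} → HasOrder a p → Path* a b → IsPowerOf a b
  reachable⇒power {a} ord-a path = path-preserves-power ord-a path (power-refl a)

mainTheorem15 : {c ℓ : Level} (G : Group c ℓ) (p : ℕ) → Prime p →
    GroupDefs.IsPGroup G p →
    ((a b : Group.Carrier G) (i : ℕ) → 1 ≤ i →
      GroupDefs.HasOrder G a p → GroupDefs.HasOrder G b (p ^ i) →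
      GroupDefs.Path* G a b → GroupDefs._⊆⟨⟩_ G a b)
    × ((a b : Group.Carrier G) →
      GroupDefs.HasOrder G a p → GroupDefs.HasOrder G b p →
      GroupDefs.Path* G a b → GroupDefs._≡⟨⟩_ G a b)
mainTheorem15 G p p-prime p-group = ⟨a⟩⊆⟨b⟩ , ⟨a⟩≡⟨b⟩
  where
  open PowerLaws G using (power⇒⊆⟨⟩; order-p-power-symmetric)
  open PGroup G p-prime p-group using (reachable⇒power)

  ⟨a⟩⊆⟨b⟩ : ∀ a b i → 1 ≤ i → GroupDefs.HasOrder G a p → GroupDefs.HasOrder G b (p ^ i) →
    GroupDefs.Path* G a b → GroupDefs._⊆⟨⟩_ G a b
  ⟨a⟩⊆⟨b⟩ a b _ _ ord-a _ path = power⇒⊆⟨⟩ (reachable⇒power ord-a path)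

  ⟨a⟩≡⟨b⟩ : ∀ a b → GroupDefs.HasOrder G a p → GroupDefs.HasOrder G b p →
    GroupDefs.Path* G a b → GroupDefs._≡⟨⟩_ G a b
  ⟨a⟩≡⟨b⟩ a b ord-a ord-b path =
    power⇒⊆⟨⟩ a∈⟨b⟩ , power⇒⊆⟨⟩ (order-p-power-symmetric p-prime ord-a ord-b a∈⟨b⟩)
    where
    a∈⟨b⟩ : GroupDefs.IsPowerOf G a b
    a∈⟨b⟩ = reachable⇒power ord-a path
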